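{- Let $F,G:\mathbf{Sets}\to\mathbf{Sets}$ be functors, $\alpha:F\Rightarrow G$ a natural transformation and $\sqsubseteq_F$ an order on $F$. If $R\subseteq X\times Y$ is a $\sqsubseteq_F$-simulation between $a:X\to FX$ and $b:Y\to FY$, then $R$ is a $\sqsubseteq_F^\alpha$-simulation between $a'=\alpha_X\circ a$ and $b'=\alpha_Y\circ b$.
   Context: An order on a functor $F$ is a family of preorders $\sqsubseteq_X\subseteq FX\times FX$ such that for all $f:X\to Y$, $u\sqsubseteq_X u'$ implies $Ff(u)\sqsubseteq_Y Ff(u')$. For $R\subseteq X\times Y$ with projections $r_1,r_2$, $R$ is a $\sqsubseteq$-simulation between coalgebras $c:X\to FX$, $d:Y\to FY$ if for all $(x,y)\in R$ there is $w\in FR$ with $c(x)\sqsubseteq Fr_1(w)$ and $Fr_2(w)\sqsubseteq d(y)$. A natural transformation $\alpha:F\Rightarrow G$ is a family $\alpha_X:FX\to GX$ with $Gf\circ\alpha_X=\alpha_Y\circ Ff$. The projected order $\sqsubseteq_F^\alpha$ on $G$ is, for each $X$, the transitive closure of the relation on $GX$ relating $x$ and $x'$ iff either $x=x'$, or there exist $x_1,x_1'\in FX$ with $x=\alpha_X(x_1)$, $x'=\alpha_X(x_1')$ and $x_1\sqsubseteq_F x_1'$. -}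

module Defs where

open import Level using (0ℓ)
open import Data.Product using (Σ; Σ-syntax; ∃; _×_; _,_; proj₁; proj₂)
open import Data.Sum using (_⊎_)
open import Function using (_∘_; id)
open import Relation.Binary.PropositionalEquality using (_≡_)
open import Relation.Binary.Construct.Closure.Transitive using (TransClosure)

record Functor : Set₁ where
  field
    F₀ : Set → Set
    F₁ : {X Y : Set} → (X → Y) → F₀ X → F₀ Y
    F-id : {X : Set} (u : F₀ X) → F₁ (id {A = X}) u ≡ u
    F-∘ : {X Y Z : Set} (g : Y → Z) (f : X → Y) (u : F₀ X) →
          F₁ (g ∘ f) u ≡ F₁ g (F₁ f u)
open Functor public

record NatTrans (F G : Functor) : Set₁ where
  field
    η : (X : Set) → F₀ F X → F₀ G X
    natural : {X Y : Set} (f : X → Y) (u : F₀ F X) →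
              F₁ G f (η X u) ≡ η Y (F₁ F f u)
open NatTrans public

record Order (F : Functor) : Set₁ where
  field
    _⊑_ : {X : Set} → F₀ F X → F₀ F X → Set
    ⊑-refl : {X : Set} (u : F₀ F X) → u ⊑ u
    ⊑-trans : {X : Set} {u v w : F₀ F X} → u ⊑ v → v ⊑ w → u ⊑ w
    ⊑-mono : {X Y : Set} (f : X → Y) {u u' : F₀ F X} →
             u ⊑ u' → F₁ F f u ⊑ F₁ F f u'
open Order public

Pairs : {X Y : Set} → (X → Y → Set) → Set
Pairs {X} {Y} R = Σ[ x ∈ X ] Σ[ y ∈ Y ] R x y

r₁ : {X Y : Set} {R : X → Y → Set} → Pairs R → X
r₁ (x , _ , _) = x

r₂ : {X Y : Set} {R : X → Y → Set} → Pairs R → Y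
r₂ (_ , y , _) = y

IsSimulation : (F : Functor) (_⊑_ : {X : Set} → F₀ F X → F₀ F X → Set)
               {X Y : Set} (R : X → Y → Set)
               (c : X → F₀ F X) (d : Y → F₀ F Y) → Set
IsSimulation F _⊑_ {X} {Y} R c d =
  (x : X) (y : Y) → R x y →
  Σ[ w ∈ F₀ F (Pairs R) ] (c x ⊑ F₁ F r₁ w) × (F₁ F r₂ w ⊑ d y)

ProjStep : {F G : Functor} (α : NatTrans F G) (⊑F : Order F)
           {X : Set} → F₀ G X → F₀ G X → Set
ProjStep {F} α ⊑F {X} x x' =
  (x ≡ x') ⊎
  (Σ[ x₁ ∈ F₀ F X ] Σ[ x₁' ∈ F₀ F X ]
     (x ≡ η α X x₁) × (x' ≡ η α X x₁') × _⊑_ ⊑F x₁ x₁')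

ProjOrder : {F G : Functor} (α : NatTrans F G) (⊑F : Order F)
            {X : Set} → F₀ G X → F₀ G X → Set
ProjOrder α ⊑F = TransClosure (ProjStep α ⊑F)

{-# OPTIONS --safe #-}
module Submission where

open import Defs
open import Function using (_∘_)
open import Data.Product using (_,_)
open import Data.Sum using (inj₂)
open import Relation.Binary.PropositionalEquality using (refl; sym; subst)
open import Relation.Binary.Construct.Closure.Transitive using ([_])

η-mono : {F G : Functor} (α : NatTrans F G) (⊑F : Order F) {X : Set}
         {u u' : F₀ F X} → _⊑_ ⊑F u u' →
         ProjOrder α ⊑F (η α X u) (η α X u')
η-mono α ⊑F {u = u} {u'} u⊑u' = [ inj₂ (u , u' , refl , refl , u⊑u') ]

theorem3 : (F G : Functor) (α : NatTrans F G) (⊑F : Order F)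
    {X Y : Set} (R : X → Y → Set)
    (a : X → F₀ F X) (b : Y → F₀ F Y) →
    IsSimulation F (_⊑_ ⊑F) R a b →
    IsSimulation G (ProjOrder α ⊑F) R (η α X ∘ a) (η α Y ∘ b)
theorem3 F G α ⊑F {X} {Y} R a b sim x y xRy with sim x y xRy
... | w , ax⊑r₁w , r₂w⊑by =
  η α (Pairs R) w
  , subst (ProjOrder α ⊑F (η α X (a x))) (sym (natural α r₁ w))
      (η-mono α ⊑F ax⊑r₁w)
  , subst (λ v → ProjOrder α ⊑F v (η α Y (b y))) (sym (natural α r₂ w))
      (η-mono α ⊑F r₂w⊑by)
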